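{- Let $r\ge 1$, $p$, $q$, $n$, $k\ge1$ be positive integers. Let $G$ be a maximal graph in $\mathcal{H}(2_r,p;q;n)$ and let $v_1,\dots,v_k$ be pairwise non-adjacent vertices of $G$. Let $H = G-\{v_1,\dots,v_k\}$. Then: (a) $H\in\mathcal{H}(2_{r-1},p;q;n-k)$; (b) for every pair of non-adjacent vertices $x,y$ of $H$, the graph $H+[x,y]$ contains a $(q-1)$-clique containing both $x$ and $y$; (c) for each $i=1,\dots,k$, $N_G(v_i)$ is a maximal (with respect to inclusion) subset of $V(H)$ which contains no $(q-1)$-clique of $H$.
   Context: All graphs are finite, simple, undirected. For a graph $G$ and positive integers $a_1,\dots,a_s$, $G \overset{v}{\rightarrow} (a_1,\dots,a_s)$ means: for every coloring of $V(G)$ with $s$ colors there is an $i$ such that $G$ contains an $a_i$-clique all of whose vertices have color $i$. $2_r$ denotes $r$ copies of $2$, so $(2_r,p)=(2,\dots,2,p)$ with $r$ twos (and $(2_0,p)=(p)$, where $G\overset{v}{\rightarrow}(p)$ means $\omega(G)\ge p$). $\mathcal{H}(a_1,\dots,a_s;q;n)$ is the set of $n$-vertex graphs $G$ with $G \overset{v}{\rightarrow} (a_1,\dots,a_s)$ and clique number $\omega(G)<q$. $G$ is maximal in this set if adding any non-edge $e$ gives $\omega(G+e)\ge q$. $N_G(v)$ is the set of neighbours of $v$ in $G$. -}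

module Defs where

open import Data.Nat using (ℕ; suc; _∸_)
open import Data.Fin using (Fin)
open import Data.Unit using (⊤)
open import Data.Bool using (Bool; true; false)
open import Data.List using (List; length; lookup; replicate; _++_; [_])
open import Data.Product using (Σ; ∃; _×_; _,_)
open import Data.Sum using (_⊎_)
open import Relation.Binary.PropositionalEquality using (_≡_; _≢_)
open import Relation.Nullary using (¬_)
open import Function.Definitions using (Injective)

record Graph (n : ℕ) : Set where
  field
    adj   : Fin n → Fin n → Bool
    sym   : ∀ x y → adj x y ≡ adj y x
    irrefl : ∀ x → adj x x ≡ false
open Graph public

Edge : ∀ {n} → Graph n → Fin n → Fin n → Set
Edge G x y = adj G x y ≡ true

EdgePlus : ∀ {n} → Graph n → Fin n → Fin n → Fin n → Fin n → Set
EdgePlus G x y a b = Edge G a b ⊎ ((a ≡ x × b ≡ y) ⊎ (a ≡ y × b ≡ x))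

IsClique : ∀ {n m} → (Fin n → Fin n → Set) → (Fin m → Fin n) → Set
IsClique E g = Injective _≡_ _≡_ g × (∀ a b → a ≢ b → E (g a) (g b))

HasCliqueIn : ∀ {n} → (Fin n → Fin n → Set) → ℕ → (Fin n → Set) → Set
HasCliqueIn {n} E m P = Σ (Fin m → Fin n) λ g → IsClique E g × (∀ a → P (g a))

HasClique : ∀ {n} → (Fin n → Fin n → Set) → ℕ → Set
HasClique E m = HasCliqueIn E m (λ _ → ⊤)

VArrows : ∀ {n} → Graph n → List ℕ → Set
VArrows {n} G as =
  (c : Fin n → Fin (length as)) →
  ∃ λ i → HasCliqueIn (Edge G) (lookup as i) (λ v → c v ≡ i)

twos : ℕ → ℕ → List ℕ
twos r p = replicate r 2 ++ [ p ]

-- G ∈ H(as; q; n)   (ω(G) < q  ⇔  no q-clique)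
InH : ∀ {n} → Graph n → List ℕ → ℕ → Set
InH G as q = VArrows G as × ¬ HasClique (Edge G) q

MaximalInH : ∀ {n} → Graph n → List ℕ → ℕ → Set
MaximalInH G as q =
  InH G as q ×
  (∀ x y → x ≢ y → ¬ Edge G x y → HasClique (EdgePlus G x y) q)

induced : ∀ {n m} → Graph n → (Fin m → Fin n) → Graph m
induced G f = record
  { adj = λ a b → adj G (f a) (f b)
  ; sym = λ a b → sym G (f a) (f b)
  ; irrefl = λ a → irrefl G (f a) }

-- f : Fin m → Fin n enumerates V(G) ∖ {v_1,…,v_k} (so induced G f ≅ G - {v_i})
Complement : ∀ {n m k} → (Fin m → Fin n) → (Fin k → Fin n) → Set
Complement {n} f v =
  Injective _≡_ _≡_ f ×
  (∀ j i → f j ≢ v i) ×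
  (∀ x → (∃ λ j → f j ≡ x) ⊎ (∃ λ i → v i ≡ x))

-- Since r ≥ 1, G contains an edge, so q ≥ 3. (a) A colouring of H extends to G by giving
-- the independent set {v_i} one extra colour, which can hold no monochromatic edge.
-- (b) For x ≁ y in H, maximality of G gives a q-clique of G + xy through x and y. It meets
-- the independent set {v_i} in at most one vertex; deleting that vertex, or else any vertex
-- other than x and y, leaves a (q-1)-clique of H + xy through x and y.
-- (c) A (q-1)-clique of H inside N(v_i) together with v_i would be a q-clique of G. If B
-- contains N(v_i) ∩ V(H) and some f j ∉ N(v_i), the q-clique of G + v_i f j passes through
-- v_i, and its other vertices are f j and neighbours of v_i, all in B.
module Submission where

open import Defs hiding (sym)
open import Data.Nat using (ℕ; zero; suc; _+_; _∸_; _≤_; _<_; z≤n; s≤s)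
open import Data.Nat.Properties using (≤-pred; ≰⇒>; m+n∸n≡m)
open import Data.Fin using (Fin; zero; suc; fromℕ<; inject≤; punchIn; punchOut; splitAt; join)
open import Data.Fin.Properties
  using (_≟_; any?; suc-injective; inject≤-injective; punchIn-injective; punchInᵢ≢i;
         punchIn-punchOut; join-splitAt; splitAt-join; cantor-schröder-bernstein)
open import Data.Product using (Σ; ∃; _×_; _,_; proj₁; proj₂)
open import Data.Sum using (_⊎_; inj₁; inj₂; [_,_]′)
import Data.Sum as Sum
open import Data.Empty using (⊥-elim)
open import Data.Unit using (tt)
open import Data.List using (lookup)
open import Relation.Binary.PropositionalEquality using (_≡_; _≢_; refl; sym; trans; cong; subst; subst₂)
open import Relation.Nullary using (¬_; yes; no)
open import Relation.Nullary.Decidable using (decidable-stable)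
open import Function using (_∘_; _on_)
open import Function.Definitions using (Injective)

private
  variable
    n m k q : ℕ

module _ (G : Graph n) where

  Edge-sym : ∀ {x y} → Edge G x y → Edge G y x
  Edge-sym {x} {y} = trans (Graph.sym G y x)

  Edge⇒≢ : ∀ {x y} → Edge G x y → x ≢ y
  Edge⇒≢ {x} e refl with trans (sym e) (irrefl G x)
  ... | ()

module _ (E : Fin n → Fin n → Set) where

  IsClique-mono : ∀ {E′ : Fin n → Fin n → Set} {g : Fin q → Fin n} →
    (∀ {x y} → E x y → E′ x y) → IsClique E g → IsClique E′ g
  IsClique-mono E⇒E′ (g-inj , g-edge) = g-inj , λ a b a≢b → E⇒E′ (g-edge a b a≢b)

  IsClique-punchIn : ∀ {g : Fin (suc q) → Fin n} c → IsClique E g → IsClique E (g ∘ punchIn c)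
  IsClique-punchIn c (g-inj , g-edge) =
    punchIn-injective c _ _ ∘ g-inj ,
    λ a b a≢b → g-edge _ _ (a≢b ∘ punchIn-injective c a b)

  IsClique-punchIn-≢ : ∀ {g : Fin (suc q) → Fin n} {c z} →
    IsClique E g → g c ≡ z → ∀ a → g (punchIn c a) ≢ z
  IsClique-punchIn-≢ {c = c} (g-inj , _) gc≡z a e = punchInᵢ≢i c a (g-inj (trans e (sym gc≡z)))

  HasCliqueIn-≤ : ∀ {q′} {P : Fin n → Set} → q ≤ q′ → HasCliqueIn E q′ P → HasCliqueIn E q P
  HasCliqueIn-≤ q≤q′ (g , (g-inj , g-edge) , g-in) =
    (λ a → g (inject≤ a q≤q′)) ,
    ((λ eq → inject≤-injective q≤q′ q≤q′ _ _ (g-inj eq)) ,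
     (λ a b a≢b → g-edge _ _ (a≢b ∘ inject≤-injective q≤q′ q≤q′ a b))) ,
    (λ a → g-in _)

  HasCliqueIn-mono : ∀ {P P′ : Fin n → Set} → (∀ {x} → P x → P′ x) →
    HasCliqueIn E q P → HasCliqueIn E q P′
  HasCliqueIn-mono P⇒P′ (g , g-clique , g-in) = g , g-clique , P⇒P′ ∘ g-in

  HasClique⇒< : ∀ {q′} → HasClique E q → ¬ HasClique E q′ → q < q′
  HasClique⇒< clique no-clique = ≰⇒> (no-clique ∘ λ q′≤q → HasCliqueIn-≤ q′≤q clique)

  module _ (f : Fin m → Fin n) where

    IsClique-pullback : (g : Fin q → Fin n) (h : Fin q → Fin m) → (∀ a → f (h a) ≡ g a) →
      IsClique E g → IsClique (E on f) h
    IsClique-pullback g h fh≗g (g-inj , g-edge) =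
      (λ {a} {b} eq → g-inj (trans (sym (fh≗g a)) (trans (cong f eq) (fh≗g b)))) ,
      λ a b a≢b → subst₂ E (sym (fh≗g a)) (sym (fh≗g b)) (g-edge a b a≢b)

    HasCliqueIn-pullback : ∀ {P : Fin m → Set} →
      HasCliqueIn E q (λ x → ∃ λ j → f j ≡ x × P j) → HasCliqueIn (E on f) q P
    HasCliqueIn-pullback (g , g-clique , g-in) =
      proj₁ ∘ g-in ,
      IsClique-pullback g (proj₁ ∘ g-in) (proj₁ ∘ proj₂ ∘ g-in) g-clique ,
      proj₂ ∘ proj₂ ∘ g-in

    HasCliqueIn-image : ∀ {P : Fin n → Set} → Injective _≡_ _≡_ f →
      HasCliqueIn (E on f) q (P ∘ f) → HasCliqueIn E q P
    HasCliqueIn-image f-inj (h , (h-inj , h-edge) , h-in) = f ∘ h , (h-inj ∘ f-inj , h-edge) , h-in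

cone : (G : Graph n) {u : Fin n} → HasCliqueIn (Edge G) q (Edge G u) → HasClique (Edge G) (suc q)
cone {n} {q} G {u} (h , (h-inj , h-edge) , h-adj) = g , (g-inj , g-edge) , λ _ → tt
  where
  g : Fin (suc q) → Fin n
  g zero = u
  g (suc a) = h a

  g-inj : Injective _≡_ _≡_ g
  g-inj {zero} {zero} _ = refl
  g-inj {zero} {suc b} eq = ⊥-elim (Edge⇒≢ G (h-adj b) eq)
  g-inj {suc a} {zero} eq = ⊥-elim (Edge⇒≢ G (h-adj a) (sym eq))
  g-inj {suc a} {suc b} eq = cong suc (h-inj eq)

  g-edge : ∀ a b → a ≢ b → Edge G (g a) (g b)
  g-edge zero zero a≢b = ⊥-elim (a≢b refl)
  g-edge zero (suc b) _ = h-adj b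
  g-edge (suc a) zero _ = Edge-sym G (h-adj a)
  g-edge (suc a) (suc b) a≢b = h-edge a b (a≢b ∘ cong suc)

HasCliqueThrough : (Fin n → Fin n → Set) → ℕ → Fin n → Fin n → Set
HasCliqueThrough {n} E q x y =
  Σ (Fin q → Fin n) λ g → IsClique E g × (∃ λ a → g a ≡ x) × (∃ λ b → g b ≡ y)

EdgeSaturated : Graph n → ℕ → Set
EdgeSaturated G q = ∀ x y → x ≢ y → ¬ Edge G x y → HasClique (EdgePlus G x y) q

module _ (G : Graph n) {x y : Fin n} where

  IsClique-EdgePlus-avoiding : {g : Fin q → Fin n} → IsClique (EdgePlus G x y) g →
    (∀ a → g a ≢ x) ⊎ (∀ a → g a ≢ y) → IsClique (Edge G) g
  IsClique-EdgePlus-avoiding {g = g} (g-inj , g-edge) avoids =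
    g-inj , λ a b a≢b → old-edge (g-edge a b a≢b)
    where
    old-edge : ∀ {a b} → EdgePlus G x y (g a) (g b) → Edge G (g a) (g b)
    old-edge (inj₁ e) = e
    old-edge {a} {b} (inj₂ (inj₁ (ga≡x , gb≡y))) =
      [ (λ ¬x → ⊥-elim (¬x a ga≡x)) , (λ ¬y → ⊥-elim (¬y b gb≡y)) ]′ avoids
    old-edge {a} {b} (inj₂ (inj₂ (ga≡y , gb≡x))) =
      [ (λ ¬x → ⊥-elim (¬x b gb≡x)) , (λ ¬y → ⊥-elim (¬y a ga≡y)) ]′ avoids

  EdgePlus-clique-contains-endpoints : ¬ HasClique (Edge G) q → {g : Fin q → Fin n} →
    IsClique (EdgePlus G x y) g → (∃ λ a → g a ≡ x) × (∃ λ b → g b ≡ y)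
  EdgePlus-clique-contains-endpoints no-clique {g} g-clique = occurs x inj₁ , occurs y inj₂
    where
    occurs : ∀ z → ((∀ a → g a ≢ z) → (∀ a → g a ≢ x) ⊎ (∀ a → g a ≢ y)) → ∃ λ a → g a ≡ z
    occurs z avoids = decidable-stable (any? λ a → g a ≟ z) λ z∉g →
      no-clique (g , IsClique-EdgePlus-avoiding g-clique (avoids λ a ga≡z → z∉g (a , ga≡z)) , λ _ → tt)

lookup-twos-positive : ∀ {p} → 1 ≤ p → ∀ r i → 1 ≤ lookup (twos r p) i
lookup-twos-positive p≥1 zero zero = p≥1
lookup-twos-positive _ (suc r) zero = s≤s z≤n
lookup-twos-positive p≥1 (suc r) (suc i) = lookup-twos-positive p≥1 r i

-- Colour every vertex with the first colour: a monochromatic clique of a later colour would be empty.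
VArrows-twos⇒HasClique-2 : (G : Graph n) → ∀ {r p} → 1 ≤ p →
  VArrows G (twos (suc r) p) → HasClique (Edge G) 2
VArrows-twos⇒HasClique-2 G {r} p≥1 arrows with arrows (λ _ → zero)
... | zero , g , g-clique , _ = g , g-clique , λ _ → tt
... | suc i , g , _ , g-colour with g-colour (fromℕ< (lookup-twos-positive p≥1 r i))
...   | ()

third-index : 2 ≤ q → (a b : Fin (suc q)) → ∃ λ c → c ≢ a × c ≢ b
third-index (s≤s (s≤s _)) (suc a) (suc b) = zero , (λ ()) , (λ ())
third-index (s≤s (s≤s _)) zero zero = suc zero , (λ ()) , (λ ())
third-index (s≤s (s≤s _)) zero (suc zero) = suc (suc zero) , (λ ()) , (λ ())
third-index (s≤s (s≤s _)) zero (suc (suc b)) = suc zero , (λ ()) , (λ ())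
third-index (s≤s (s≤s _)) (suc zero) zero = suc (suc zero) , (λ ()) , (λ ())
third-index (s≤s (s≤s _)) (suc (suc a)) zero = suc zero , (λ ()) , (λ ())

all-but-one-outside-independent : (E : Fin n → Fin n → Set) (v : Fin k → Fin n) →
  (∀ i j → ¬ E (v i) (v j)) → 2 ≤ q → {g : Fin (suc q) → Fin n} → IsClique E g →
  ∀ {a b} → (∀ i → g a ≢ v i) → (∀ i → g b ≢ v i) →
  ∃ λ c → c ≢ a × c ≢ b × (∀ d → d ≢ c → ∀ i → g d ≢ v i)
all-but-one-outside-independent E v v-indep 2≤q {g} (_ , g-edge) {a} {b} a∉v b∉v
  with any? (λ c → any? (λ i → g c ≟ v i))
... | yes (c , i , gc≡vi) =
  c , (λ { refl → a∉v i gc≡vi }) , (λ { refl → b∉v i gc≡vi }) ,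
  λ d d≢c j gd≡vj → v-indep i j (subst₂ E gc≡vi gd≡vj (g-edge c d (d≢c ∘ sym)))
... | no g∩v≡∅ with third-index 2≤q a b
...   | c , c≢a , c≢b = c , c≢a , c≢b , λ d _ i gd≡vi → g∩v≡∅ (d , i , gd≡vi)

complement-size : {f : Fin m → Fin n} {v : Fin k → Fin n} →
  Injective _≡_ _≡_ v → Complement f v → m + k ≡ n
complement-size {m} {n} {k} {f} {v} v-inj (f-inj , f≢v , cover) =
  cantor-schröder-bernstein {f = merge ∘ splitAt m} {g = join m k ∘ source}
    (λ {i} {j} eq → trans (sym (join-splitAt m k i))
                   (trans (cong (join m k) (merge-injective (splitAt m i) (splitAt m j) eq))
                          (join-splitAt m k j)))
    (λ {x} {y} eq → trans (sym (merge-source x))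
                   (trans (cong merge (trans (sym (splitAt-join m k (source x)))
                                      (trans (cong (splitAt m) eq) (splitAt-join m k (source y)))))
                          (merge-source y)))
  where
  merge : Fin m ⊎ Fin k → Fin n
  merge = [ f , v ]′

  source : Fin n → Fin m ⊎ Fin k
  source x = Sum.map proj₁ proj₁ (cover x)

  merge-source : ∀ x → merge (source x) ≡ x
  merge-source x with cover x
  ... | inj₁ (_ , fj≡x) = fj≡x
  ... | inj₂ (_ , vi≡x) = vi≡x

  merge-injective : ∀ s t → merge s ≡ merge t → s ≡ t
  merge-injective (inj₁ a) (inj₁ b) eq = cong inj₁ (f-inj eq)
  merge-injective (inj₁ a) (inj₂ b) eq = ⊥-elim (f≢v a b eq)
  merge-injective (inj₂ a) (inj₁ b) eq = ⊥-elim (f≢v b a (sym eq))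
  merge-injective (inj₂ a) (inj₂ b) eq = cong inj₂ (v-inj eq)

module Deletion (G : Graph n) {v : Fin k → Fin n} (v-indep : ∀ i j → ¬ Edge G (v i) (v j))
  {f : Fin m → Fin n} (f-inj : Injective _≡_ _≡_ f) (f≢v : ∀ j i → f j ≢ v i)
  (cover : ∀ x → (∃ λ j → f j ≡ x) ⊎ (∃ λ i → v i ≡ x)) where

  H : Graph m
  H = induced G f

  kept : ∀ {x} → (∀ i → x ≢ v i) → ∃ λ j → f j ≡ x
  kept {x} x∉v with cover x
  ... | inj₁ x∈f = x∈f
  ... | inj₂ (i , vi≡x) = ⊥-elim (x∉v i (sym vi≡x))

  image-outside : ∀ {x z} → x ≡ f z → ∀ i → x ≢ v i
  image-outside x≡fz i x≡vi = f≢v _ i (trans (sym x≡fz) x≡vi)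

  EdgePlus-induced : ∀ {x y a b} → EdgePlus G (f x) (f y) (f a) (f b) → EdgePlus H x y a b
  EdgePlus-induced (inj₁ e) = inj₁ e
  EdgePlus-induced (inj₂ (inj₁ (a≡x , b≡y))) = inj₂ (inj₁ (f-inj a≡x , f-inj b≡y))
  EdgePlus-induced (inj₂ (inj₂ (a≡y , b≡x))) = inj₂ (inj₂ (f-inj a≡y , f-inj b≡x))

  EdgePlus-independent : ∀ {x y} i j → ¬ EdgePlus G (f x) (f y) (v i) (v j)
  EdgePlus-independent i j (inj₁ e) = v-indep i j e
  EdgePlus-independent i j (inj₂ (inj₁ (vi≡fx , _))) = f≢v _ i (sym vi≡fx)
  EdgePlus-independent i j (inj₂ (inj₂ (vi≡fy , _))) = f≢v _ i (sym vi≡fy)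

  extend : ∀ {L} → (Fin m → Fin L) → Fin n → Fin (suc L)
  extend c x = [ (λ (j , _) → suc (c j)) , (λ _ → zero) ]′ (cover x)

  extend-zero : ∀ {L} (c : Fin m → Fin L) x → extend c x ≡ zero → ∃ λ i → v i ≡ x
  extend-zero c x _ with cover x
  extend-zero c x () | inj₁ _
  extend-zero c x _  | inj₂ x∈v = x∈v

  extend-suc : ∀ {L} (c : Fin m → Fin L) {l x} → extend c x ≡ suc l → ∃ λ j → f j ≡ x × c j ≡ l
  extend-suc c {x = x} _ with cover x
  extend-suc c eq | inj₁ (j , fj≡x) = j , fj≡x , suc-injective eq
  extend-suc c () | inj₂ _

  VArrows-H : ∀ {r p} → VArrows G (twos (suc r) p) → VArrows H (twos r p)
  VArrows-H arrows c with arrows (extend c)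
  ... | zero , g , (_ , g-edge) , g-colour
    with extend-zero c (g zero) (g-colour zero) | extend-zero c (g (suc zero)) (g-colour (suc zero))
  ...   | i , vi≡g₀ | j , vj≡g₁ =
    ⊥-elim (v-indep i j (subst₂ (Edge G) (sym vi≡g₀) (sym vj≡g₁) (g-edge zero (suc zero) λ ())))
  VArrows-H arrows c | suc l , clique =
    l , HasCliqueIn-pullback (Edge G) f (HasCliqueIn-mono (Edge G) (λ {x} → extend-suc c {x = x}) clique)

  ¬HasClique-H : ¬ HasClique (Edge G) q → ¬ HasClique (Edge H) q
  ¬HasClique-H no-clique = no-clique ∘ HasCliqueIn-image (Edge G) f f-inj

  EdgePlus-clique⇒EdgePlus-H-clique : 2 ≤ q → ∀ {x y} {g : Fin (suc q) → Fin n} →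
    IsClique (EdgePlus G (f x) (f y)) g → ∀ {a b} → g a ≡ f x → g b ≡ f y →
    HasCliqueThrough (EdgePlus H x y) q x y
  EdgePlus-clique⇒EdgePlus-H-clique 2≤q {x} {y} {g} g-clique ga≡fx gb≡fy
    with all-but-one-outside-independent (EdgePlus G (f x) (f y)) v EdgePlus-independent 2≤q g-clique
           (image-outside ga≡fx) (image-outside gb≡fy)
  ... | c , c≢a , c≢b , rest-outside =
    h , IsClique-mono (EdgePlus G (f x) (f y) on f) EdgePlus-induced
      (IsClique-pullback (EdgePlus G (f x) (f y)) f (g ∘ punchIn c) h fh≗g
        (IsClique-punchIn (EdgePlus G (f x) (f y)) c g-clique)) ,
    (punchOut c≢a , located c≢a ga≡fx) , (punchOut c≢b , located c≢b gb≡fy)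
    where
    preimage : ∀ a → ∃ λ j → f j ≡ g (punchIn c a)
    preimage a = kept (rest-outside (punchIn c a) (punchInᵢ≢i c a))

    h : Fin _ → Fin m
    h = proj₁ ∘ preimage

    fh≗g : ∀ a → f (h a) ≡ g (punchIn c a)
    fh≗g = proj₂ ∘ preimage

    located : ∀ {d z} (c≢d : c ≢ d) → g d ≡ f z → h (punchOut c≢d) ≡ z
    located c≢d gd≡fz = f-inj (trans (fh≗g _) (trans (cong g (punchIn-punchOut c≢d)) gd≡fz))

  new-edge-closes-clique-H : ¬ HasClique (Edge G) (suc q) → 2 ≤ q → EdgeSaturated G (suc q) →
    ∀ x y → x ≢ y → ¬ Edge H x y →
    HasCliqueThrough (EdgePlus H x y) q x y
  new-edge-closes-clique-H no-clique 2≤q saturated x y x≢y x≁y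
    with saturated (f x) (f y) (x≢y ∘ f-inj) x≁y
  ... | g , g-clique , _ with EdgePlus-clique-contains-endpoints G no-clique g-clique
  ...   | (_ , ga≡fx) , (_ , gb≡fy) = EdgePlus-clique⇒EdgePlus-H-clique 2≤q g-clique ga≡fx gb≡fy

  neighbourhood-clique-free : ¬ HasClique (Edge G) (suc q) →
    ∀ i → ¬ HasCliqueIn (Edge H) q (λ j → Edge G (v i) (f j))
  neighbourhood-clique-free no-clique i =
    no-clique ∘ cone G ∘ HasCliqueIn-image (Edge G) f {P = Edge G (v i)} f-inj

  neighbourhood-maximal : ¬ HasClique (Edge G) (suc q) → EdgeSaturated G (suc q) →
    ∀ i (B : Fin m → Set) → (∀ j → Edge G (v i) (f j) → B j) → (∃ λ j → B j × ¬ Edge G (v i) (f j)) →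
    HasCliqueIn (Edge H) q B
  neighbourhood-maximal no-clique saturated i B N⊆B (j , Bj , vi≁fj)
    with saturated (v i) (f j) (λ vi≡fj → f≢v j i (sym vi≡fj)) vi≁fj
  ... | g , g-clique , _ with EdgePlus-clique-contains-endpoints G no-clique g-clique
  ...   | (c , gc≡vi) , _ =
    HasCliqueIn-pullback (Edge G) f
      ( g ∘ punchIn c
      , IsClique-EdgePlus-avoiding G (IsClique-punchIn (EdgePlus G (v i) (f j)) c g-clique)
          (inj₁ (IsClique-punchIn-≢ (EdgePlus G (v i) (f j)) g-clique gc≡vi))
      , λ a → neighbour-in-B (subst (λ u → EdgePlus G (v i) (f j) u (g (punchIn c a))) gc≡vi
                                    (proj₂ g-clique c (punchIn c a) (punchInᵢ≢i c a ∘ sym))))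
    where
    neighbour-in-B : ∀ {z} → EdgePlus G (v i) (f j) (v i) z → ∃ λ j′ → f j′ ≡ z × B j′
    neighbour-in-B (inj₁ e) with kept (λ i′ z≡vi′ → v-indep i i′ (subst (Edge G (v i)) z≡vi′ e))
    ... | j′ , fj′≡z = j′ , fj′≡z , N⊆B j′ (subst (Edge G (v i)) (sym fj′≡z) e)
    neighbour-in-B (inj₂ (inj₁ (_ , z≡fj))) = j , sym z≡fj , Bj
    neighbour-in-B (inj₂ (inj₂ (vi≡fj , _))) = ⊥-elim (f≢v j i (sym vi≡fj))

proposition1 : (r p q n k m : ℕ) → 1 ≤ r → 1 ≤ p → 1 ≤ q → 1 ≤ n → 1 ≤ k →
    (G : Graph n) → MaximalInH G (twos r p) q →
    (v : Fin k → Fin n) → Injective _≡_ _≡_ v → (∀ i j → ¬ Edge G (v i) (v j)) →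
    (f : Fin m → Fin n) → Complement f v →
    (m ≡ n ∸ k) ×
    InH (induced G f) (twos (r ∸ 1) p) q ×
    (∀ x y → x ≢ y → ¬ Edge (induced G f) x y →
      Σ (Fin (q ∸ 1) → Fin m) λ g → IsClique (EdgePlus (induced G f) x y) g ×
        (∃ λ a → g a ≡ x) × (∃ λ b → g b ≡ y)) ×
    (∀ i →
      ¬ HasCliqueIn (Edge (induced G f)) (q ∸ 1) (λ j → Edge G (v i) (f j)) ×
      (∀ (B : Fin m → Set) → (∀ j → Edge G (v i) (f j) → B j) →
        (∃ λ j → B j × ¬ Edge G (v i) (f j)) →
        HasCliqueIn (Edge (induced G f)) (q ∸ 1) B))
proposition1 zero _ _ _ _ _ ()
proposition1 (suc _) _ zero _ _ _ _ _ ()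
proposition1 (suc r) p (suc q) n k m _ p≥1 _ _ _ G ((arrows , no-clique) , saturated)
             v v-inj v-indep f complement@(f-inj , f≢v , cover) =
  trans (sym (m+n∸n≡m m k)) (cong (_∸ k) (complement-size v-inj complement)) ,
  (VArrows-H arrows , ¬HasClique-H no-clique) ,
  new-edge-closes-clique-H no-clique 2≤q saturated ,
  λ i → neighbourhood-clique-free no-clique i , neighbourhood-maximal no-clique saturated i
  where
  open Deletion G v-indep f-inj f≢v cover

  2≤q : 2 ≤ q
  2≤q = ≤-pred (HasClique⇒< (Edge G) (VArrows-twos⇒HasClique-2 G p≥1 arrows) no-clique)
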